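{- For all positive integers $s$ and $H$ there exists an integer $n$ such that the game $\langle K_{1,n},h_{s,H},g_s\rangle$ is winning.
   Context: $K_{1,n}$ is the star with center $A$ and $n$ leaves. The functions on its vertices are: - $h_{s,H}(v)=s+1$ for $v\ne A$, and $h_{s,H}(A)=H$; - $g_s(v)=1$ for $v\ne A$, and $g_s(A)=s$. Hat guessing game $\langle G,h,g\rangle$: $G=(V,E)$ is a finite graph and $h,g\colon V\to\mathbb N$. The adversary gives each vertex $v$ a color in $\{0,\dots,h(v)-1\}$. Each vertex sees only its neighbors' colors and names at most $g(v)$ colors via a deterministic strategy fixed in advance that depends only on those colors. The game is winning if some strategy ensures that for every assignment some vertex names its own color. -}

module Defs where

open import Data.Nat using (ℕ; zero; suc; _≤_)
open import Data.Fin using (Fin; zero; suc)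
open import Data.List using (List; length)
open import Data.List.Membership.Propositional using (_∈_)
open import Data.Product using (Σ; ∃; _×_)
open import Data.Unit using (⊤)
open import Data.Empty using (⊥)
open import Relation.Binary.PropositionalEquality using (_≡_)

record Graph : Set₁ where
  field
    N   : ℕ
    Adj : Fin N → Fin N → Set

open Graph public

Coloring : (G : Graph) → (Fin (N G) → ℕ) → Set
Coloring G h = (v : Fin (N G)) → Fin (h v)

record Strategy (G : Graph) (h g : Fin (N G) → ℕ) : Set where
  field
    guess   : (v : Fin (N G)) → Coloring G h → List (Fin (h v))
    local   : (v : Fin (N G)) (c c′ : Coloring G h) →
              ((u : Fin (N G)) → Adj G v u → c u ≡ c′ u) →
              guess v c ≡ guess v c′
    bounded : (v : Fin (N G)) (c : Coloring G h) → length (guess v c) ≤ g v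

open Strategy public

Winning : (G : Graph) (h g : Fin (N G) → ℕ) → Set
Winning G h g = Σ (Strategy G h g) λ S →
  (c : Coloring G h) → ∃ λ v → c v ∈ guess S v c

-- The star K_{1,n}: vertex zero is the centre A, vertices suc i are leaves.
StarAdj : {n : ℕ} → Fin (suc n) → Fin (suc n) → Set
StarAdj zero    zero    = ⊥
StarAdj zero    (suc _) = ⊤
StarAdj (suc _) zero    = ⊤
StarAdj (suc _) (suc _) = ⊥

Star : ℕ → Graph
Star n = record { N = suc n ; Adj = StarAdj }

hStar : (n s H : ℕ) → Fin (suc n) → ℕ
hStar n s H zero    = H
hStar n s H (suc _) = suc s

gStar : (n s : ℕ) → Fin (suc n) → ℕ
gStar n s zero    = s
gStar n s (suc _) = 1

-- Index the leaves by all functions f : Fin H → Fin (s+1); leaf f guesses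
-- f applied to the centre's colour.  The centre, seeing the leaf colours x,
-- names every colour y that no leaf would guess correctly, i.e. with
-- x_f ≢ f y for all f.  If the centre's colour is not named, some leaf is
-- right.  And at most s colours are named: given s+1 of them, pick f mapping
-- them onto all of Fin (s+1); then x_f = f y for one of them, so that y was
-- not named after all.
module Submission where

open import Defs
open import Data.Bool using (Bool; true; false; if_then_else_; T)
open import Data.Fin using (Fin; zero; suc; finToFun; funToFin)
open import Data.Fin.Properties using (all?; ¬∀⟶∃¬; finToFun-funToFin; _≟_)
open import Data.List using (List; []; _∷_; map; length)
open import Data.List.Properties using (length-map)
open import Data.List.Membership.Propositional using (_∈_)
open import Data.List.Membership.Propositional.Properties using (∈-map⁺)
open import Data.List.Relation.Unary.Any using (here; there)
open import Data.Nat using (ℕ; zero; suc; _≥_; _≤_; _<_; _^_; z≤n; s≤s)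
open import Data.Nat.Properties using (≮⇒≥)
open import Data.Product using (∃; _,_; _×_)
open import Data.Vec using (Vec; lookup; tabulate)
open import Data.Vec.Properties using (tabulate-cong; lookup∘tabulate)
open import Function using (_∘_)
open import Relation.Binary.PropositionalEquality using (_≡_; _≢_; refl; sym; trans; cong; subst)
open import Relation.Nullary using (¬_; Dec; yes; no; ¬?)
open import Relation.Nullary.Decidable using (isYes; toWitness; fromWitness; decidable-stable)

select : ∀ {H} → (Fin H → Bool) → List (Fin H)
select {zero}  Q = []
select {suc H} Q = if Q zero then zero ∷ rest else rest
  where rest = map suc (select (Q ∘ suc))

∈-select : ∀ {H} (Q : Fin H → Bool) {y} → T (Q y) → y ∈ select Q
∈-select Q {zero} t with Q zero
... | true = here refl
∈-select Q {zero} () | false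
∈-select Q {suc y} t with Q zero
... | true  = there (∈-map⁺ suc (∈-select (Q ∘ suc) t))
... | false = ∈-map⁺ suc (∈-select (Q ∘ suc) t)

-- Numbers the selected elements 0, 1, …, s in increasing order; all later
-- elements (and the unselected ones) get junk labels.
label : ∀ {H} (s : ℕ) → (Fin H → Bool) → Fin H → Fin (suc s)
label zero    Q y       = zero
label (suc s) Q zero    = zero
label (suc s) Q (suc y) = if Q zero then suc (label s (Q ∘ suc) y)
                                   else label (suc s) (Q ∘ suc) y

label-suc-selected : ∀ {H} s (Q : Fin (suc H) → Bool) {y} → Q zero ≡ true →
                     label (suc s) Q (suc y) ≡ suc (label s (Q ∘ suc) y)
label-suc-selected s Q eq rewrite eq = refl

label-suc-unselected : ∀ {H} s (Q : Fin (suc H) → Bool) {y} → Q zero ≡ false →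
                       label s Q (suc y) ≡ label s (Q ∘ suc) y
label-suc-unselected zero    Q eq = refl
label-suc-unselected (suc s) Q eq rewrite eq = refl

label-surjective : ∀ {H} s (Q : Fin H → Bool) → s < length (select Q) →
                   (j : Fin (suc s)) → ∃ λ y → T (Q y) × label s Q y ≡ j
label-surjective {zero} s Q ()
label-surjective {suc H} s Q s<len j with Q zero in eq
... | true = selected s j (subst (s <_) (cong suc (length-map suc (select (Q ∘ suc)))) s<len)
  where
  selected : ∀ s (j : Fin (suc s)) → s < suc (length (select (Q ∘ suc))) →
             ∃ λ y → T (Q y) × label s Q y ≡ j
  selected zero    zero    _ = zero , subst T (sym eq) _ , refl
  selected (suc s) zero    _ = zero , subst T (sym eq) _ , refl
  selected (suc s) (suc j) (s≤s s<len′) with label-surjective s (Q ∘ suc) s<len′ j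
  ... | y , t , e = suc y , t , trans (label-suc-selected s Q eq) (cong suc e)
... | false with label-surjective s (Q ∘ suc) (subst (s <_) (length-map suc (select (Q ∘ suc))) s<len) j
...   | y , t , e = suc y , t , trans (label-suc-unselected s Q eq) e

module StarGame (s H : ℕ) where

  n : ℕ
  n = suc s ^ H

  leafRule : Fin n → Fin H → Fin (suc s)
  leafRule = finToFun

  Unguessed : Vec (Fin (suc s)) n → Fin H → Set
  Unguessed x y = ∀ i → lookup x i ≢ leafRule i y

  unguessed? : ∀ x y → Dec (Unguessed x y)
  unguessed? x y = all? (λ i → ¬? (lookup x i ≟ leafRule i y))

  centreGuess : Vec (Fin (suc s)) n → List (Fin H)
  centreGuess x = select (isYes ∘ unguessed? x)

  -- The leaf funToFin φ is the one mapping the named colours onto Fin (s+1).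
  ¬s<length-centreGuess : ∀ x → ¬ s < length (centreGuess x)
  ¬s<length-centreGuess x s<len =
    let Q           = isYes ∘ unguessed? x
        φ           = label s Q
        i           = funToFin φ
        (y , t , e) = label-surjective s Q s<len (lookup x i)
    in toWitness t i (sym (trans (finToFun-funToFin φ y) e))

  Colouring : Set
  Colouring = Coloring (Star n) (hStar n s H)

  leafColours : Colouring → Vec (Fin (suc s)) n
  leafColours c = tabulate (c ∘ suc)

  starStrategy : Strategy (Star n) (hStar n s H) (gStar n s)
  starStrategy = record { guess = guess′ ; local = local′ ; bounded = bounded′ }
    where
    guess′ : (v : Fin (suc n)) → Colouring → List (Fin (hStar n s H v))
    guess′ zero    c = centreGuess (leafColours c)
    guess′ (suc i) c = leafRule i (c zero) ∷ []

    local′ : (v : Fin (suc n)) (c c′ : Colouring) →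
             ((u : Fin (suc n)) → StarAdj v u → c u ≡ c′ u) → guess′ v c ≡ guess′ v c′
    local′ zero    c c′ agree = cong centreGuess (tabulate-cong (λ i → agree (suc i) _))
    local′ (suc i) c c′ agree = cong (λ a → leafRule i a ∷ []) (agree zero _)

    bounded′ : (v : Fin (suc n)) (c : Colouring) → length (guess′ v c) ≤ gStar n s v
    bounded′ zero    c = ≮⇒≥ (¬s<length-centreGuess (leafColours c))
    bounded′ (suc i) c = s≤s z≤n

  starStrategy-wins : (c : Colouring) → ∃ λ v → c v ∈ guess starStrategy v c
  starStrategy-wins c with unguessed? (leafColours c) (c zero)
  ... | yes u = zero , ∈-select (isYes ∘ unguessed? (leafColours c)) (fromWitness u)
  ... | no ¬u with ¬∀⟶∃¬ n _ (λ i → ¬? (lookup (leafColours c) i ≟ leafRule i (c zero))) ¬u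
  ...   | i , ¬¬hit = suc i , here (trans (sym (lookup∘tabulate (c ∘ suc) i))
                                        (decidable-stable (_ ≟ _) ¬¬hit))

lemma3p5 : (s H : ℕ) → s ≥ 1 → H ≥ 1 →
    ∃ λ n → Winning (Star n) (hStar n s H) (gStar n s)
lemma3p5 s H _ _ = n , starStrategy , starStrategy-wins
  where open StarGame s H
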